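{- Let $G$ be a finite simple graph with vertices $v_1,\ldots,v_n$ and let $L$ be a list of $G$. Then $$\overrightarrow{W}(G,L)=R(\overrightarrow{W}_{max}(G,L)),$$ i.e. $G$ is $(L,w)$-colorable if and only if there exists $\vec w'\in\overrightarrow{W}_{max}(G,L)$ with $\vec w\le\vec w'$.
   Context: A list of $G$ is a map $L$ assigning to each vertex $v$ a finite set $L(v)\subset\mathbb{N}$; $\overline{L}=\bigcup_{v}L(v)$. A weight is a map $w:V(G)\to\mathbb{N}$, with weight-vector $\vec w=\sum_i w(v_i)\vec e_i\in\mathbb N^n$. An $(L,w)$-coloring of $G$ is a map $C$ with $C(v)\subset L(v)$, $|C(v)|=w(v)$ for all $v$, and $C(v)\cap C(v')=\emptyset$ for every edge $vv'$; $G$ is $(L,w)$-colorable if such a coloring exists. $\overrightarrow{W}(G,L)$ is the set of weight-vectors $\vec w\in\mathbb N^n$ such that $G$ is $(L,w)$-colorable. On $\mathbb N^n$, $\vec y\le\vec x$ means $y_i\le x_i$ for all $i$; for a finite set $X\subset\mathbb N^n$, $R(X)=\{\vec y\in\mathbb N^n:\vec y\le\vec x$ for some $\vec x\in X\}$. For $N\subset V(G)$, $\vec N=\sum_i\lambda_i\vec e_i$ with $\lambda_i=1$ if $v_i\in N$ and $0$ otherwise. For a color $x$, $G^x$ is the subgraph of $G$ induced by the vertices $v$ with $x\in L(v)$. For a subgraph $H$, $\overrightarrow{MIS}(H)=\{\vec N\in\mathbb N^n: N$ is a maximal (w.r.t. inclusion) independent set of $H\}$. $\overrightarrow{W}_{max}(G,L)=\sum_{x\in\overline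 L}\overrightarrow{MIS}(G^x)$, the vectorial sum (all sums $\sum_x\vec z_x$ with $\vec z_x\in\overrightarrow{MIS}(G^x)$). -}

module Defs where

open import Data.Nat using (ℕ; _≤_; _+_)
open import Data.Nat.Properties using (_≟_)
open import Data.Bool using (Bool; true; false; if_then_else_)
open import Data.Fin using (Fin)
open import Data.Fin.Subset using (Subset; Side; inside; outside; _∈_; _∉_; _⊆_)
open import Data.Vec using (lookup)
open import Data.List using (List; []; _∷_; length; map; concat; deduplicate; foldr; allFin)
open import Data.List.Relation.Unary.Unique.Propositional using (Unique)
import Data.List.Membership.Propositional as LM
open import Data.Product using (Σ; _×_; ∃; ∃-syntax)
open import Data.Empty using (⊥)
open import Data.List.Base using ()
open import Relation.Binary.PropositionalEquality using (_≡_)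

-- A finite simple graph on the vertex set Fin n (vertex i = v_{i+1}):
-- symmetric, irreflexive (loopless) Boolean adjacency.
record Graph (n : ℕ) : Set where
  field
    adj   : Fin n → Fin n → Bool
    sym   : ∀ u v → adj u v ≡ adj v u
    irrefl : ∀ v → adj v v ≡ false

open Graph public

Edge : ∀ {n} → Graph n → Fin n → Fin n → Set
Edge G u v = adj G u v ≡ true

-- A list of G: each vertex gets a finite set of colors (given as a list of naturals;
-- only membership matters).
ListAssignment : ℕ → Set
ListAssignment n = Fin n → List ℕ

Weight : ℕ → Set
Weight n = Fin n → ℕ

_≤ᵥ_ : ∀ {n} → Weight n → Weight n → Set
y ≤ᵥ x = ∀ i → y i ≤ x i

record IsColoring {n} (G : Graph n) (L : ListAssignment n) (w : Weight n)
                  (C : Fin n → List ℕ) : Set where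
  field
    unique   : ∀ v → Unique (C v)
    size     : ∀ v → length (C v) ≡ w v
    inList   : ∀ v x → x LM.∈ C v → x LM.∈ L v
    disjoint : ∀ v v' → Edge G v v' → ∀ x → x LM.∈ C v → x LM.∈ C v' → ⊥

Colorable : ∀ {n} → Graph n → ListAssignment n → Weight n → Set
Colorable G L w = ∃[ C ] IsColoring G L w C

InW : ∀ {n} → Graph n → ListAssignment n → Weight n → Set
InW G L w = Colorable G L w

Lbar : ∀ {n} → ListAssignment n → List ℕ
Lbar {n} L = deduplicate _≟_ (concat (map L (allFin n)))

-- Vertices of G^x: those v with x ∈ L(v).
InGx : ∀ {n} → ListAssignment n → ℕ → Fin n → Set
InGx L x v = x LM.∈ L v

IsIndepIn : ∀ {n} → Graph n → ListAssignment n → ℕ → Subset n → Set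
IsIndepIn G L x N =
  (∀ v → v ∈ N → InGx L x v) × (∀ u v → u ∈ N → v ∈ N → Edge G u v → ⊥)

IsMISIn : ∀ {n} → Graph n → ListAssignment n → ℕ → Subset n → Set
IsMISIn G L x N =
  IsIndepIn G L x N × (∀ N' → IsIndepIn G L x N' → N ⊆ N' → N' ⊆ N)

charVec : ∀ {n} → Subset n → Weight n
charVec N i with lookup N i
... | inside  = 1
... | outside = 0

sumVec : ∀ {n} → List ℕ → (ℕ → Subset n) → Weight n
sumVec []       N i = 0
sumVec (x ∷ xs) N i = charVec (N x) i + sumVec xs N i

-- W_max(G,L) = Σ_{x ∈ L̄} MIS(G^x): w' is a vectorial sum Σ_x \vec N_x with each
-- N_x a maximal independent set of G^x.
InWmax : ∀ {n} → Graph n → ListAssignment n → Weight n → Set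
InWmax G L w' = ∃[ N ] ((∀ x → x LM.∈ Lbar L → IsMISIn G L x (N x))
                        × (∀ i → w' i ≡ sumVec (Lbar L) N i))

InRWmax : ∀ {n} → Graph n → ListAssignment n → Weight n → Set
InRWmax G L w = ∃[ w' ] (InWmax G L w' × w ≤ᵥ w')

-- In an (L,w)-colouring the vertices receiving colour x form an independent set of G^x,
-- and conversely, given independent sets N_x of the G^x, a vertex v may take any w(v) of
-- the colours x with v ∈ N_x. Every independent set of G^x extends greedily to a maximal
-- one, which only enlarges the number of admissible colours at each vertex; hence the
-- colourable weights are exactly those below a sum of characteristic vectors of maximal
-- independent sets.
module Submission where

open import Defs hiding (sym)
open import Data.Nat using (ℕ; suc; _≤_; z≤n; s≤s)
open import Data.Nat.Properties using (≤-trans; ≤-reflexive; m≤n⇒m⊓n≡m; _≟_)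
open import Data.Bool using (true; false)
import Data.Bool.Properties as Bool
open import Data.Fin using (Fin)
open import Data.Fin.Properties using (any?)
open import Data.Fin.Subset using (Subset; _∈_; _⊆_; _∪_; ⁅_⁆)
open import Data.Fin.Subset.Properties using (x∈p∪q⁺; x∈p∪q⁻; x∈⁅x⁆; x∈⁅y⁆⇒x≡y)
import Data.Fin.Subset.Properties as Subset
open import Data.Vec using (lookup; tabulate)
open import Data.Vec.Properties using (lookup∘tabulate; []=⇒lookup; lookup⇒[]=)
open import Data.List using (List; []; _∷_; length; map; concat; filter; take; allFin)
open import Data.List.Properties using (filter-notAll; length-take)
open import Data.List.Relation.Unary.Any using (here; there)
import Data.List.Relation.Unary.Any as Any
import Data.List.Relation.Unary.All as All
open import Data.List.Relation.Unary.Unique.Propositional using (Unique; _∷_)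
import Data.List.Relation.Unary.Unique.Propositional.Properties as Unique
open import Data.List.Relation.Unary.Unique.DecPropositional.Properties using (deduplicate-!)
import Data.List.Membership.Propositional as List
open import Data.List.Membership.Propositional.Properties
  using (∈-filter⁺; ∈-filter⁻; ∈-deduplicate⁺; ∈-concat⁺′; ∈-map⁺; ∈-allFin)
import Data.List.Membership.DecPropositional as DecMembership
import Data.List.Relation.Binary.Sublist.Propositional as Sublist
open import Data.List.Relation.Binary.Sublist.Propositional.Properties using (take-⊆)
open import Data.Product using (_×_; _,_; proj₁; proj₂; ∃-syntax)
open import Data.Sum using (_⊎_; inj₁; inj₂)
open import Data.Empty using (⊥; ⊥-elim)
open import Function using (id; _∘_)
open import Function.Bundles using (_⇔_; mk⇔)
open import Relation.Binary.Definitions using (DecidableEquality)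
open import Relation.Binary.PropositionalEquality using (_≡_; refl; sym; trans; cong; subst)
open import Relation.Nullary using (yes; no; ¬_; does)
open import Relation.Nullary.Decidable using (_×-dec_; ¬?)
open import Relation.Unary using (Pred; Decidable)
open import Level using (0ℓ)

private
  variable
    n : ℕ

module _ {a} {A : Set a} (_≟ᴬ_ : DecidableEquality A) where

  Unique⇒length≤ : ∀ {ys} xs → Unique ys → (∀ {z} → z List.∈ ys → z List.∈ xs) →
                   length ys ≤ length xs
  Unique⇒length≤ {[]}     xs _           _     = z≤n
  Unique⇒length≤ {y ∷ ys} xs (y∉ys ∷ ys!) ys⊆xs =
    ≤-trans (s≤s (Unique⇒length≤ (filter ≢y? xs) ys! ys⊆xs-y))
            (filter-notAll ≢y? xs (Any.map (λ { refl y≢y → y≢y refl }) (ys⊆xs (here refl))))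
    where
    ≢y? : Decidable (λ z → ¬ z ≡ y)
    ≢y? z = ¬? (z ≟ᴬ y)
    ys⊆xs-y : ∀ {z} → z List.∈ ys → z List.∈ filter ≢y? xs
    ys⊆xs-y z∈ys =
      ∈-filter⁺ ≢y? (ys⊆xs (there z∈ys)) (λ { refl → All.lookup y∉ys z∈ys refl })

subsetOf : {P : Pred (Fin n) 0ℓ} → Decidable P → Subset n
subsetOf P? = tabulate (does ∘ P?)

module _ {P : Pred (Fin n) 0ℓ} (P? : Decidable P) where

  ∈-subsetOf⁺ : ∀ {v} → P v → v ∈ subsetOf P?
  ∈-subsetOf⁺ {v} Pv with P? v in eq
  ... | yes _ = lookup⇒[]= v _ (trans (lookup∘tabulate _ v) (cong does eq))
  ... | no ¬Pv = ⊥-elim (¬Pv Pv)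

  ∈-subsetOf⁻ : ∀ {v} → v ∈ subsetOf P? → P v
  ∈-subsetOf⁻ {v} v∈ with P? v in eq
  ... | yes Pv = Pv
  ... | no _ with () ← trans (sym ([]=⇒lookup v∈)) (trans (lookup∘tabulate _ v) (cong does eq))

charVec-∈ : ∀ (N : Subset n) {i} → i ∈ N → charVec N i ≡ 1
charVec-∈ N i∈N rewrite []=⇒lookup i∈N = refl

charVec-∉ : ∀ (N : Subset n) i → ¬ i ∈ N → charVec N i ≡ 0
charVec-∉ N i i∉N with lookup N i in eq
... | true  = ⊥-elim (i∉N (lookup⇒[]= i N eq))
... | false = refl

coloursAt : (ℕ → Subset n) → List ℕ → Fin n → List ℕ
coloursAt N xs v = filter ((v Subset.∈?_) ∘ N) xs

sumVec≡length-coloursAt : ∀ (N : ℕ → Subset n) xs v → sumVec xs N v ≡ length (coloursAt N xs v)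
sumVec≡length-coloursAt N [] v = refl
sumVec≡length-coloursAt N (x ∷ xs) v with v Subset.∈? N x
... | yes v∈ rewrite charVec-∈ (N x) v∈ = cong suc (sumVec≡length-coloursAt N xs v)
... | no  v∉ rewrite charVec-∉ (N x) v v∉ = sumVec≡length-coloursAt N xs v

module _ (G : Graph n) (P : Pred (Fin n) 0ℓ) where

  -- Definitionally, IsIndepIn G L x = Independent G (InGx L x) and
  -- IsMISIn G L x = MaximalIndependent G (InGx L x).
  Independent : Subset n → Set
  Independent N = (∀ v → v ∈ N → P v) × (∀ u v → u ∈ N → v ∈ N → Edge G u v → ⊥)

  MaximalIndependent : Subset n → Set
  MaximalIndependent N = Independent N × (∀ N' → Independent N' → N ⊆ N' → N' ⊆ N)

  Dominates : Subset n → Fin n → Set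
  Dominates N v = v ∈ N ⊎ ¬ P v ⊎ ∃[ u ] u ∈ N × Edge G u v

  Dominates-mono : ∀ {N M v} → N ⊆ M → Dominates N v → Dominates M v
  Dominates-mono N⊆M (inj₁ v∈N)                = inj₁ (N⊆M v∈N)
  Dominates-mono N⊆M (inj₂ (inj₁ ¬Pv))         = inj₂ (inj₁ ¬Pv)
  Dominates-mono N⊆M (inj₂ (inj₂ (u , u∈N , e))) = inj₂ (inj₂ (u , N⊆M u∈N , e))

  dominating⇒maximal : ∀ {N} → Independent N → (∀ v → Dominates N v) → MaximalIndependent N
  dominating⇒maximal indep dom = indep , maximal
    where
    maximal : ∀ N' → Independent N' → _ ⊆ N' → N' ⊆ _
    maximal N' (inP , noEdge) N⊆N' {v} v∈N' with dom v
    ... | inj₁ v∈N                  = v∈N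
    ... | inj₂ (inj₁ ¬Pv)           = ⊥-elim (¬Pv (inP v v∈N'))
    ... | inj₂ (inj₂ (u , u∈N , e)) = ⊥-elim (noEdge u v (N⊆N' u∈N) v∈N' e)

  ∪-⁅⁆-independent : ∀ {N v} → Independent N → P v → (∀ u → u ∈ N → ¬ Edge G u v) →
                     Independent (N ∪ ⁅ v ⁆)
  ∪-⁅⁆-independent {N} {v} (inP , noEdge) Pv free = inP′ , noEdge′
    where
    inP′ : ∀ u → u ∈ N ∪ ⁅ v ⁆ → P u
    inP′ u u∈ with x∈p∪q⁻ N _ u∈
    ... | inj₁ u∈N = inP u u∈N
    ... | inj₂ u∈v rewrite x∈⁅y⁆⇒x≡y v u∈v = Pv
    noEdge′ : ∀ u u' → u ∈ N ∪ ⁅ v ⁆ → u' ∈ N ∪ ⁅ v ⁆ → Edge G u u' → ⊥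
    noEdge′ u u' u∈ u'∈ e with x∈p∪q⁻ N _ u∈ | x∈p∪q⁻ N _ u'∈
    ... | inj₁ u∈N | inj₁ u'∈N = noEdge u u' u∈N u'∈N e
    ... | inj₁ u∈N | inj₂ u'∈v rewrite x∈⁅y⁆⇒x≡y v u'∈v = free u u∈N e
    ... | inj₂ u∈v | inj₁ u'∈N rewrite x∈⁅y⁆⇒x≡y v u∈v =
      free u' u'∈N (trans (Graph.sym G u' v) e)
    ... | inj₂ u∈v | inj₂ u'∈v rewrite x∈⁅y⁆⇒x≡y v u∈v | x∈⁅y⁆⇒x≡y v u'∈v
      with () ← trans (sym e) (irrefl G v)

  module _ (P? : Decidable P) where

    extend-to-dominate : ∀ {N} → Independent N → ∀ v →
                         ∃[ M ] N ⊆ M × Independent M × Dominates M v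
    extend-to-dominate {N} indep v
      with P? v | any? (λ u → u Subset.∈? N ×-dec (adj G u v Bool.≟ true))
    ... | no ¬Pv | _                      = N , id , indep , inj₂ (inj₁ ¬Pv)
    ... | yes _  | yes (u , u∈N , e)      = N , id , indep , inj₂ (inj₂ (u , u∈N , e))
    ... | yes Pv | no noNeighbour         =
      N ∪ ⁅ v ⁆ , x∈p∪q⁺ ∘ inj₁ ,
      ∪-⁅⁆-independent indep Pv (λ u u∈N e → noNeighbour (u , u∈N , e)) ,
      inj₁ (x∈p∪q⁺ (inj₂ (x∈⁅x⁆ v)))

    extend-to-dominate-all : ∀ {N} → Independent N → (vs : List (Fin n)) →
                             ∃[ M ] N ⊆ M × Independent M × (∀ {v} → v List.∈ vs → Dominates M v)
    extend-to-dominate-all {N} indep [] = N , id , indep , λ ()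
    extend-to-dominate-all {N} indep (v ∷ vs)
      with M , N⊆M , indepM , domv ← extend-to-dominate indep v
      with K , M⊆K , indepK , domvs ← extend-to-dominate-all indepM vs
      = K , M⊆K ∘ N⊆M , indepK ,
        λ { (here refl) → Dominates-mono M⊆K domv ; (there v∈vs) → domvs v∈vs }

    extend-to-maximal : ∀ {N} → Independent N → ∃[ M ] N ⊆ M × MaximalIndependent M
    extend-to-maximal indep
      with M , N⊆M , indepM , dom ← extend-to-dominate-all indep (allFin _)
      = M , N⊆M , dominating⇒maximal indepM (λ v → dom (∈-allFin v))

∈-Lbar : ∀ (L : ListAssignment n) v {x} → x List.∈ L v → x List.∈ Lbar L
∈-Lbar L v x∈Lv = ∈-deduplicate⁺ _≟_ (∈-concat⁺′ x∈Lv (∈-map⁺ L (∈-allFin v)))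

Lbar-unique : ∀ (L : ListAssignment n) → Unique (Lbar L)
Lbar-unique L = deduplicate-! _≟_ (concat (map L (allFin _)))

module _ {G : Graph n} {L : ListAssignment n} where

  open DecMembership _≟_ using () renaming (_∈?_ to _∈ₗ?_)

  -- Each colour class of a colouring is an independent set of G^x; extending every
  -- class to a maximal one can only raise the number of classes containing v.
  colorable⇒InRWmax : ∀ {w} → Colorable G L w → InRWmax G L w
  colorable⇒InRWmax {w} (C , isColoring) =
    sumVec (Lbar L) N , (N , (λ x _ → maximalN x) , λ _ → refl) , w≤
    where
    open IsColoring isColoring
    coloured? : ∀ x → Decidable (λ v → x List.∈ C v)
    coloured? x v = x ∈ₗ? C v
    class : ℕ → Subset n
    class x = subsetOf (coloured? x)
    class-independent : ∀ x → Independent G (InGx L x) (class x)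
    class-independent x =
      (λ v v∈ → inList v x (∈-subsetOf⁻ (coloured? x) v∈)) ,
      (λ u v u∈ v∈ e →
        disjoint u v e x (∈-subsetOf⁻ (coloured? x) u∈) (∈-subsetOf⁻ (coloured? x) v∈))
    maximal-class : ∀ x → ∃[ M ] class x ⊆ M × IsMISIn G L x M
    maximal-class x = extend-to-maximal G (InGx L x) (λ v → x ∈ₗ? L v) (class-independent x)
    N : ℕ → Subset n
    N x = proj₁ (maximal-class x)
    maximalN : ∀ x → IsMISIn G L x (N x)
    maximalN x = proj₂ (proj₂ (maximal-class x))
    C⊆coloursAt : ∀ v {x} → x List.∈ C v → x List.∈ coloursAt N (Lbar L) v
    C⊆coloursAt v {x} x∈Cv =
      ∈-filter⁺ ((v Subset.∈?_) ∘ N) (∈-Lbar L v (inList v x x∈Cv))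
        (proj₁ (proj₂ (maximal-class x)) (∈-subsetOf⁺ (coloured? x) x∈Cv))
    w≤ : w ≤ᵥ sumVec (Lbar L) N
    w≤ v = subst (_≤ sumVec (Lbar L) N v) (size v)
             (≤-trans (Unique⇒length≤ _≟_ _ (unique v) (C⊆coloursAt v))
                      (≤-reflexive (sym (sumVec≡length-coloursAt N (Lbar L) v))))

  -- Colour v with the first w(v) colours x whose chosen set N x contains v.
  InRWmax⇒colorable : ∀ {w} → InRWmax G L w → Colorable G L w
  InRWmax⇒colorable {w} (w' , (N , maximalN , w'≡) , w≤w') = C , record
    { unique   = λ v →
                   Unique.take⁺ (w v) (Unique.filter⁺ ((v Subset.∈?_) ∘ N) (Lbar-unique L))
    ; size     = size
    ; inList   = λ v x x∈Cv → let x∈Lbar , v∈Nx = ∈-C⁻ x∈Cv in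
                   proj₁ (proj₁ (maximalN x x∈Lbar)) v v∈Nx
    ; disjoint = λ v v' e x x∈Cv x∈Cv' → let x∈Lbar , v∈Nx = ∈-C⁻ x∈Cv in
                   proj₂ (proj₁ (maximalN x x∈Lbar)) v v' v∈Nx (proj₂ (∈-C⁻ x∈Cv')) e
    }
    where
    C : Fin n → List ℕ
    C v = take (w v) (coloursAt N (Lbar L) v)
    ∈-C⁻ : ∀ {v x} → x List.∈ C v → x List.∈ Lbar L × v ∈ N x
    ∈-C⁻ {v} x∈Cv = ∈-filter⁻ ((v Subset.∈?_) ∘ N) (Sublist.lookup (take-⊆ (w v) _) x∈Cv)
    size : ∀ v → length (C v) ≡ w v
    size v = trans (length-take (w v) (coloursAt N (Lbar L) v))
                   (m≤n⇒m⊓n≡m (≤-trans (w≤w' v)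
                     (≤-reflexive (trans (w'≡ v) (sumVec≡length-coloursAt N (Lbar L) v)))))

theorem4p1 : (n : ℕ) (G : Graph n) (L : ListAssignment n) (w : Weight n) →
             InW G L w ⇔ InRWmax G L w
theorem4p1 _ _ _ _ = mk⇔ colorable⇒InRWmax InRWmax⇒colorable
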